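{- Let $k\in\mathbb{N}$ and let $\mathbf{A},\mathbf{B}$ be $\sigma$-structures. Then (i) there is a homomorphism $\mathbf{A}\to\mathbf{B}$ if and only if there is a homomorphism $\mathbf{A}^{\otimes k}\to\mathbf{B}^{\otimes k}$; (ii) if $\mathbf{A}$ is $k$-enhanced, there is a bijection between $\mathrm{Hom}(\mathbf{A},\mathbf{B})$ and $\mathrm{Hom}(\mathbf{A}^{\otimes k},\mathbf{B}^{\otimes k})$.
   Context: A $\sigma$-structure $\mathbf{A}$ has domain $A$ and relations $R^{\mathbf{A}}\subseteq A^{\mathrm{ar}(R)}$; homomorphisms preserve all relations coordinatewise; $\mathrm{Hom}(\mathbf{A},\mathbf{B})$ denotes the set of homomorphisms $\mathbf{A}\to\mathbf{B}$. A $\sigma$-structure is $k$-enhanced if $\sigma$ contains a $k$-ary symbol $R_k$ with $R_k^{\mathbf{A}}=A^k$. For $\mathbf{a}=(a_1,\dots,a_r)$ and $\mathbf{i}=(i_1,\dots,i_k)\in[r]^k$, $\mathbf{a}_{\mathbf{i}}=(a_{i_1},\dots,a_{i_k})$. Tensor power: $\mathbf{A}^{\otimes k}$ has the same symbols, where $R$ of arity $r$ gets arity $r^k$ with positions indexed by $[r]^k$; domain $A^k$; $R^{\mathbf{A}^{\otimes k}}=\{\mathbf{a}^{\otimes k}:\mathbf{a}\in R^{\mathbf{A}}\}$ with $\mathbf{a}^{\otimes k}$ the family whose $\mathbf{i}$-th entry is $\mathbf{a}_{\mathbf{i}}\in A^k$. Maps are applied to such families entrywise. -}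

module Defs where

open import Data.Nat using (ℕ)
open import Data.Fin using (Fin)
open import Data.Vec using (Vec; map; lookup)
open import Data.Product using (Σ; ∃; _×_; _,_; proj₁)
open import Relation.Binary.PropositionalEquality using (_≡_; refl; sym; trans)
open import Relation.Binary.Bundles using (Setoid)

record Signature : Set₁ where
  field
    Sym : Set
    ar  : Sym → ℕ
open Signature public

record Structure (σ : Signature) : Set₁ where
  field
    Carrier : Set
    rel     : (R : Sym σ) → Vec Carrier (ar σ R) → Set
open Structure public

Hom : {σ : Signature} → Structure σ → Structure σ → Set
Hom {σ} A B =
  Σ (Carrier A → Carrier B) λ f →
    (R : Sym σ) (a : Vec (Carrier A) (ar σ R)) → rel A R a → rel B R (map f a)

HomSetoid : {σ : Signature} → Structure σ → Structure σ → Setoid _ _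
HomSetoid A B = record
  { Carrier = Hom A B
  ; _≈_ = λ f g → ∀ x → proj₁ f x ≡ proj₁ g x
  ; isEquivalence = record
      { refl = λ x → refl
      ; sym = λ p x → sym (p x)
      ; trans = λ p q x → trans (p x) (q x) } }

Enhanced : {σ : Signature} → ℕ → Structure σ → Set
Enhanced {σ} k A =
  Σ (Sym σ) λ R → (ar σ R ≡ k) × ((t : Vec (Carrier A) (ar σ R)) → rel A R t)

-- The symbol R (arity r) gets tuples whose positions
-- are indexed by [r]^k (here Vec (Fin r) k); the domain is A^k (Vec A k).
_at_ : {A : Set} {r k : ℕ} → Vec A r → Vec (Fin r) k → Vec A k
a at i = map (lookup a) i

tensorTuple : {A : Set} {r : ℕ} (k : ℕ) → Vec A r → (Vec (Fin r) k → Vec A k)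
tensorTuple k a i = a at i

record TensorStructure (σ : Signature) (k : ℕ) : Set₁ where
  field
    TCarrier : Set
    trel     : (R : Sym σ) → (Vec (Fin (ar σ R)) k → TCarrier) → Set
open TensorStructure public

_⊗_ : {σ : Signature} → Structure σ → (k : ℕ) → TensorStructure σ k
A ⊗ k = record
  { TCarrier = Vec (Carrier A) k
  ; trel = λ R T → ∃ λ a → rel A R a × (∀ i → T i ≡ tensorTuple k a i) }

THom : {σ : Signature} {k : ℕ} → TensorStructure σ k → TensorStructure σ k → Set
THom {σ} {k} A B =
  Σ (TCarrier A → TCarrier B) λ g →
    (R : Sym σ) (T : Vec (Fin (ar σ R)) k → TCarrier A) →
      trel A R T → trel B R (λ i → g (T i))

THomSetoid : {σ : Signature} {k : ℕ} → TensorStructure σ k → TensorStructure σ k → Setoid _ _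
THomSetoid A B = record
  { Carrier = THom A B
  ; _≈_ = λ f g → ∀ x → proj₁ f x ≡ proj₁ g x
  ; isEquivalence = record
      { refl = λ x → refl
      ; sym = λ p x → sym (p x)
      ; trans = λ p q x → trans (p x) (q x) } }

{-# OPTIONS --safe #-}
module Submission where

-- A homomorphism f : A → B acts coordinatewise on A^k.  Conversely, a
-- homomorphism g of tensor powers is read on the diagonal, x ↦ head (g (x,…,x)):
-- the entry of a^{⊗k} at (j,…,j) is the constant tuple (a_j,…,a_j), so g maps
-- it to (b_j,…,b_j) where b^{⊗k} is the image of a^{⊗k}, and the diagonal map
-- sends a to b.  If A is k-enhanced, every x ∈ A^k is an entry of some a^{⊗k}
-- with a ∈ R_k, so g itself is the coordinatewise action of its diagonal.

open import Defs
open import Data.Nat using (ℕ; suc; _≤_; s≤s; z≤n)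
open import Data.Fin using (Fin)
open import Data.Vec using (Vec; map; lookup; head; replicate; allFin)
open import Data.Vec.Properties using (map-∘; map-cong; lookup-map; map-replicate; map-lookup-allFin)
open import Data.Vec.Relation.Binary.Pointwise.Extensional using (ext; Pointwise-≡⇒≡)
open import Data.Product using (_×_; _,_; ∃₂)
open import Function using (_∘_)
open import Function.Bundles using (_⇔_; Inverse; mk⇔)
open import Relation.Binary.PropositionalEquality using (_≡_; refl; sym; trans; cong; subst; module ≡-Reasoning)

private variable
  C D : Set
  r k : ℕ

map-at : (f : C → D) (a : Vec C r) (i : Vec (Fin r) k) → map f (a at i) ≡ map f a at i
map-at f a i = trans (sym (map-∘ f (lookup a) i)) (map-cong (λ j → sym (lookup-map j f a)) i)

at-surjective : r ≡ k → (x : Vec C k) → ∃₂ λ (a : Vec C r) i → a at i ≡ x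
at-surjective refl x = x , allFin _ , map-lookup-allFin x

diagonal : (Vec C (suc k) → Vec D (suc k)) → C → D
diagonal g x = head (g (replicate _ x))

map-diagonal : (g : Vec C (suc k) → Vec D (suc k)) (a : Vec C r) (b : Vec D r) →
               (∀ i → g (a at i) ≡ b at i) → map (diagonal g) a ≡ b
map-diagonal {k = k} g a b g-tensored = Pointwise-≡⇒≡ (ext λ j → begin
  lookup (map (diagonal g) a) j           ≡⟨ lookup-map j (diagonal g) a ⟩
  head (g (replicate _ (lookup a j)))     ≡⟨ cong (head ∘ g) (sym (map-replicate (lookup a) j (suc k))) ⟩
  head (g (a at replicate _ j))           ≡⟨ cong head (g-tensored (replicate _ j)) ⟩
  lookup b j                              ∎)
  where open ≡-Reasoning

tensored-diagonal : (g : Vec C (suc k) → Vec D (suc k)) (a : Vec C r) (b : Vec D r) →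
                    (∀ i → g (a at i) ≡ b at i) → ∀ i → map (diagonal g) (a at i) ≡ g (a at i)
tensored-diagonal g a b g-tensored i = begin
  map (diagonal g) (a at i)   ≡⟨ map-at (diagonal g) a i ⟩
  map (diagonal g) a at i     ≡⟨ cong (_at i) (map-diagonal g a b g-tensored) ⟩
  b at i                      ≡⟨ sym (g-tensored i) ⟩
  g (a at i)                  ∎
  where open ≡-Reasoning

module _ {σ : Signature} (A B : Structure σ) where

  tensorHom : Hom A B → THom (A ⊗ k) (B ⊗ k)
  tensorHom (f , f-hom) = map f , λ where
    R T (a , a∈R , T≡a⊗) → map f a , f-hom R a a∈R ,
                             λ i → trans (cong (map f) (T≡a⊗ i)) (map-at f a i)

  diagonalHom : THom (A ⊗ suc k) (B ⊗ suc k) → Hom A B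
  diagonalHom (g , g-hom) = diagonal g , λ R a a∈R →
    let b , b∈R , g-tensored = g-hom R (tensorTuple _ a) (a , a∈R , λ _ → refl)
    in subst (rel B R) (sym (map-diagonal g a b g-tensored)) b∈R

  map-diagonal-enhanced : Enhanced (suc k) A → ((g , _) : THom (A ⊗ suc k) (B ⊗ suc k)) →
                          ∀ x → map (diagonal g) x ≡ g x
  map-diagonal-enhanced (R , arR≡k , full) (g , g-hom) x with at-surjective arR≡k x
  ... | a , i , refl with g-hom R (tensorTuple _ a) (a , full a , λ _ → refl)
  ... | b , _ , g-tensored = tensored-diagonal g a b g-tensored i

  tensorHom-inverse : Enhanced (suc k) A →
                      Inverse (HomSetoid A B) (THomSetoid (A ⊗ suc k) (B ⊗ suc k))
  tensorHom-inverse enhanced = record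
    { to        = tensorHom
    ; from      = diagonalHom
    ; to-cong   = map-cong
    ; from-cong = λ g≈g′ x → cong head (g≈g′ (replicate _ x))
    ; inverse   = (λ {G} f≈G↓ x → trans (map-cong f≈G↓ x) (map-diagonal-enhanced enhanced G x))
                , (λ g≈f↑ x → cong head (g≈f↑ (replicate _ x)))
    }

lemma4p7 : (σ : Signature) (k : ℕ) → 1 ≤ k → (A B : Structure σ) →
    (Hom A B ⇔ THom (A ⊗ k) (B ⊗ k))
    × (Enhanced k A → Inverse (HomSetoid A B) (THomSetoid (A ⊗ k) (B ⊗ k)))
lemma4p7 σ (suc k) (s≤s z≤n) A B =
  mk⇔ (tensorHom A B) (diagonalHom A B) , tensorHom-inverse A B
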